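{- If $\mathbb{A}$ is a semi De Morgan algebra (resp. a demi pseudocomplemented lattice), then $\mathbb{A}^+$ is a heterogeneous semi De Morgan algebra (resp. a heterogeneous demi pseudocomplemented lattice).
   Context: A semi De Morgan algebra (SMA) is an algebra $(L,\wedge,\vee,{}',\top,\bot)$ such that $(L,\wedge,\vee,\top,\bot)$ is a bounded distributive lattice and for all $a,b\in L$: $\bot'=\top$, $\top'=\bot$, $(a\vee b)'=a'\wedge b'$, $(a\wedge b)''=a''\wedge b''$, $a'=a'''$. A demi pseudocomplemented lattice (DPL) is an SMA with $a'\wedge a''=\bot$ for all $a$. For an SMA $\mathbb{A}$, let $K=\{a'':a\in L\}$, $h:L\to K$, $h(a)=a''$, $e:K\to L$ the inclusion, and let the kernel $\mathbb{K}=(K,\cap,\cup,{}^*,1,0)$ have $\alpha\cup\beta=h((e(\alpha)\vee e(\beta))'')$, $\alpha\cap\beta=h(e(\alpha)\wedge e(\beta))$, $1=h(\top)$, $0=h(\bot)$, $\alpha^*=h(e(\alpha)')$. Define $\mathbb{A}^+=(\mathbb{L},\mathbb{K},e,h)$, where $\mathbb{L}$ is the bounded lattice reduct of $\mathbb{A}$. A heterogeneous semi De Morgan algebra (HSMA) is a tuple $(\mathbb{L},\mathbb{D},e,h)$ with: $\mathbb{L}$ a bounded distributive lattice; $\mathbb{D}=(D,\cap,\cup,{}^*,1,0)$ a De Morgan algebra (bounded distributive lattice with $0^*=1$, $1^*=0$, $(a\cup b)^*=a^*\cap b^*$, $(a\cap b)^*=a^*\cup b^*$, $a^{**}=a$);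 $e:\mathbb{D}\to\mathbb{L}$ an order embedding with $e(\alpha_1)\wedge e(\alpha_2)=e(\alpha_1\cap\alpha_2)$, $e(1)=\top$, $e(0)=\bot$; $h:\mathbb{L}\to\mathbb{D}$ a surjective lattice homomorphism; and $h(e(\alpha))=\alpha$ for all $\alpha\in D$. A heterogeneous demi pseudocomplemented lattice (HDPL) is defined in the same way but with $\mathbb{D}$ a Boolean algebra (a De Morgan algebra with $a\cap a^*=0$). -}

module Defs where

open import Level using (Level; _⊔_; suc)
open import Relation.Binary.Core using (Rel)
open import Relation.Binary.Structures using (IsEquivalence)
open import Data.Product using (Σ; ∃; _,_; proj₁; _×_)
open import Function.Bundles using (_⇔_)
open import Algebra.Core using (Op₁; Op₂)
import Algebra.Definitions as AD
import Algebra.Lattice.Structures as LS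

record IsBoundedDistributiveLattice {c ℓ} {A : Set c} (_≈_ : Rel A ℓ)
       (_∧_ _∨_ : Op₂ A) (⊤ ⊥ : A) : Set (c ⊔ ℓ) where
  field
    isDistributiveLattice : LS.IsDistributiveLattice _≈_ _∨_ _∧_
    ∧-identityʳ : ∀ a → (a ∧ ⊤) ≈ a
    ∨-identityʳ : ∀ a → (a ∨ ⊥) ≈ a

record IsDeMorganAlgebra {c ℓ} {A : Set c} (_≈_ : Rel A ℓ)
       (_∩_ _∪_ : Op₂ A) (_* : Op₁ A) (1D 0D : A) : Set (c ⊔ ℓ) where
  field
    isBDL  : IsBoundedDistributiveLattice _≈_ _∩_ _∪_ 1D 0D
    *-cong : ∀ {a b} → a ≈ b → (a *) ≈ (b *)
    0*     : (0D *) ≈ 1D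
    1*     : (1D *) ≈ 0D
    ∪*     : ∀ a b → ((a ∪ b) *) ≈ ((a *) ∩ (b *))
    ∩*     : ∀ a b → ((a ∩ b) *) ≈ ((a *) ∪ (b *))
    **     : ∀ a → ((a *) *) ≈ a

record IsBooleanDM {c ℓ} {A : Set c} (_≈_ : Rel A ℓ)
       (_∩_ _∪_ : Op₂ A) (_* : Op₁ A) (1D 0D : A) : Set (c ⊔ ℓ) where
  field
    isDeMorgan : IsDeMorganAlgebra _≈_ _∩_ _∪_ _* 1D 0D
    ∩-compl    : ∀ a → (a ∩ (a *)) ≈ 0D

record SMA (c ℓ : Level) : Set (suc (c ⊔ ℓ)) where
  infixr 7 _∧_
  infixr 6 _∨_
  infix  4 _≈_
  field
    Carrier : Set c
    _≈_     : Rel Carrier ℓ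
    _∧_ _∨_ : Op₂ Carrier
    _′      : Op₁ Carrier
    ⊤ ⊥     : Carrier
    isBDL   : IsBoundedDistributiveLattice _≈_ _∧_ _∨_ ⊤ ⊥
    ′-cong  : ∀ {a b} → a ≈ b → a ′ ≈ b ′
    ⊥′      : ⊥ ′ ≈ ⊤
    ⊤′      : ⊤ ′ ≈ ⊥
    ∨′      : ∀ a b → (a ∨ b) ′ ≈ a ′ ∧ b ′
    ∧′′     : ∀ a b → ((a ∧ b) ′) ′ ≈ (a ′) ′ ∧ (b ′) ′
    ′′′     : ∀ a → a ′ ≈ ((a ′) ′) ′

IsDPL : ∀ {c ℓ} → SMA c ℓ → Set (c ⊔ ℓ)
IsDPL A = ∀ a → (a ′ ∧ (a ′) ′) ≈ ⊥
  where open SMA A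

record RawBL (c ℓ : Level) : Set (suc (c ⊔ ℓ)) where
  field
    Carrier : Set c
    _≈_     : Rel Carrier ℓ
    _∧_ _∨_ : Op₂ Carrier
    ⊤ ⊥     : Carrier

record RawDM (c ℓ : Level) : Set (suc (c ⊔ ℓ)) where
  field
    Carrier : Set c
    _≈_     : Rel Carrier ℓ
    _∩_ _∪_ : Op₂ Carrier
    _*      : Op₁ Carrier
    1D 0D   : Carrier

module _ {c₁ ℓ₁ c₂ ℓ₂} (L : RawBL c₁ ℓ₁) (D : RawDM c₂ ℓ₂) where
  private
    module L = RawBL L
    module D = RawDM D

  _≤L_ : Rel L.Carrier ℓ₁
  a ≤L b = L._≈_ (L._∧_ a b) a

  _≤D_ : Rel D.Carrier ℓ₂
  α ≤D β = D._≈_ (D._∩_ α β) α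

  record IsHSMA (e : D.Carrier → L.Carrier) (h : L.Carrier → D.Carrier)
         : Set (c₁ ⊔ ℓ₁ ⊔ c₂ ⊔ ℓ₂) where
    field
      L-isBDL      : IsBoundedDistributiveLattice L._≈_ L._∧_ L._∨_ L.⊤ L.⊥
      D-isDeMorgan : IsDeMorganAlgebra D._≈_ D._∩_ D._∪_ D._* D.1D D.0D
      e-cong       : ∀ {α β} → D._≈_ α β → L._≈_ (e α) (e β)
      e-order-emb  : ∀ α β → (α ≤D β) ⇔ (e α ≤L e β)
      e-∩          : ∀ α β → L._≈_ (L._∧_ (e α) (e β)) (e (D._∩_ α β))
      e-1          : L._≈_ (e D.1D) L.⊤
      e-0          : L._≈_ (e D.0D) L.⊥
      h-cong       : ∀ {a b} → L._≈_ a b → D._≈_ (h a) (h b)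
      h-∧          : ∀ a b → D._≈_ (h (L._∧_ a b)) (D._∩_ (h a) (h b))
      h-∨          : ∀ a b → D._≈_ (h (L._∨_ a b)) (D._∪_ (h a) (h b))
      h-surj       : ∀ α → ∃ λ a → D._≈_ (h a) α
      h∘e          : ∀ α → D._≈_ (h (e α)) α

  record IsHDPL (e : D.Carrier → L.Carrier) (h : L.Carrier → D.Carrier)
         : Set (c₁ ⊔ ℓ₁ ⊔ c₂ ⊔ ℓ₂) where
    field
      isHSMA  : IsHSMA e h
      D-compl : ∀ α → D._≈_ (D._∩_ α (D._* α)) D.0D

module Plus {c ℓ} (A : SMA c ℓ) where
  open SMA A

  𝕃 : RawBL c ℓ
  𝕃 = record { Carrier = Carrier ; _≈_ = _≈_ ; _∧_ = _∧_ ; _∨_ = _∨_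
             ; ⊤ = ⊤ ; ⊥ = ⊥ }

  K : Set (c ⊔ ℓ)
  K = Σ Carrier λ x → ∃ λ a → x ≈ (a ′) ′

  _≈K_ : Rel K ℓ
  (x , _) ≈K (y , _) = x ≈ y

  h : Carrier → K
  h a = (a ′) ′ , a , IsEquivalence.refl isEquivalence
    where open LS.IsDistributiveLattice
                 (IsBoundedDistributiveLattice.isDistributiveLattice isBDL)

  e : K → Carrier
  e = proj₁

  𝕂 : RawDM (c ⊔ ℓ) ℓ
  𝕂 = record
    { Carrier = K
    ; _≈_ = _≈K_
    ; _∩_ = λ α β → h (e α ∧ e β)
    ; _∪_ = λ α β → h (((e α ∨ e β) ′) ′)
    ; _*  = λ α → h (e α ′)
    ; 1D  = h ⊤
    ; 0D  = h ⊥
    }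

module Submission where

-- The whole argument rests on the double-negation map a ↦ a″ = a′′ and on
-- viewing h(a) = a″ as a surjective homomorphism from A onto its kernel 𝕂.
--   * A general fact, proved first: the image of a bounded distributive
--     lattice under a surjective lattice homomorphism is again one.
--   * The SMA axioms give a handful of identities for ″: it is idempotent,
--     a″′ = a′, and ″ may be inserted or removed under ∧ and ∨ inside an
--     outer ″; moreover (a ∧ b)′ = (a′ ∨ b′)″.
--   * Consequently h preserves ∧, ∨ and ′ (onto the kernel operations ∩,
--     ∪, *), and every element of 𝕂 is a fixed point of ″.  The general
--     fact makes 𝕂 a bounded distributive lattice; the De Morgan laws of
--     𝕂, the embedding properties of e, and (for a DPL) the Boolean
--     complement law follow from the identities above by short calculations.

open import Defs
open import Level using (Level)
open import Data.Product using (_×_; _,_; proj₁; proj₂; ∃)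
open import Function.Bundles using (mk⇔)
open import Algebra.Core using (Op₂)
open import Algebra.Definitions using (Congruent₂)
open import Relation.Binary.Core using (Rel)
open import Relation.Binary.Bundles using (Setoid)
open import Relation.Binary.Structures using (IsEquivalence)
import Algebra.Lattice.Structures as LS
import Algebra.Consequences.Setoid as Consequences
import Relation.Binary.Reasoning.Setoid as SetoidReasoning

-- A surjective homomorphism h from a bounded distributive lattice onto a
-- setoid K carrying two congruent operations makes K a bounded
-- distributive lattice with bounds h ⊤ and h ⊥: every identity is checked
-- on representatives h a, where it reduces to the identity in L.
module HomomorphicImage
  {a ℓ b ℓ′} {L : Set a} {_≈_ : Rel L ℓ} {_∧_ _∨_ : Op₂ L} {⊤ ⊥ : L}
  (L-isBDL : IsBoundedDistributiveLattice _≈_ _∧_ _∨_ ⊤ ⊥)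
  {K : Set b} {_≈K_ : Rel K ℓ′} {_⊓_ _⊔_ : Op₂ K}
  (≈K-isEquivalence : IsEquivalence _≈K_)
  (⊓-cong : Congruent₂ _≈K_ _⊓_)
  (⊔-cong : Congruent₂ _≈K_ _⊔_)
  (h : L → K)
  (h-cong : ∀ {x y} → x ≈ y → h x ≈K h y)
  (h-∧ : ∀ x y → h (x ∧ y) ≈K (h x ⊓ h y))
  (h-∨ : ∀ x y → h (x ∨ y) ≈K (h x ⊔ h y))
  (h-surj : ∀ α → ∃ λ x → h x ≈K α)
  where

  open IsBoundedDistributiveLattice L-isBDL
  open LS.IsDistributiveLattice isDistributiveLattice

  K-setoid : Setoid b ℓ′
  K-setoid = record { isEquivalence = ≈K-isEquivalence }

  open Setoid K-setoid using () renaming (refl to reflK; sym to symK)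
  open SetoidReasoning K-setoid
  open Consequences K-setoid using (comm∧distrˡ⇒distr)

  rep : K → L
  rep α = proj₁ (h-surj α)

  h-rep : ∀ α → h (rep α) ≈K α
  h-rep α = proj₂ (h-surj α)

  ⊓-rep : ∀ α β → (α ⊓ β) ≈K h (rep α ∧ rep β)
  ⊓-rep α β = symK (begin
    h (rep α ∧ rep β)       ≈⟨ h-∧ (rep α) (rep β) ⟩
    h (rep α) ⊓ h (rep β)   ≈⟨ ⊓-cong (h-rep α) (h-rep β) ⟩
    α ⊓ β                   ∎)

  ⊔-rep : ∀ α β → (α ⊔ β) ≈K h (rep α ∨ rep β)
  ⊔-rep α β = symK (begin
    h (rep α ∨ rep β)       ≈⟨ h-∨ (rep α) (rep β) ⟩
    h (rep α) ⊔ h (rep β)   ≈⟨ ⊔-cong (h-rep α) (h-rep β) ⟩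
    α ⊔ β                   ∎)

  ⊓-comm : ∀ α β → (α ⊓ β) ≈K (β ⊓ α)
  ⊓-comm α β = begin
    α ⊓ β                ≈⟨ ⊓-rep α β ⟩
    h (rep α ∧ rep β)    ≈⟨ h-cong (∧-comm (rep α) (rep β)) ⟩
    h (rep β ∧ rep α)    ≈⟨ symK (⊓-rep β α) ⟩
    β ⊓ α                ∎

  ⊔-comm : ∀ α β → (α ⊔ β) ≈K (β ⊔ α)
  ⊔-comm α β = begin
    α ⊔ β                ≈⟨ ⊔-rep α β ⟩
    h (rep α ∨ rep β)    ≈⟨ h-cong (∨-comm (rep α) (rep β)) ⟩
    h (rep β ∨ rep α)    ≈⟨ symK (⊔-rep β α) ⟩
    β ⊔ α                ∎

  ⊓-assoc : ∀ α β γ → ((α ⊓ β) ⊓ γ) ≈K (α ⊓ (β ⊓ γ))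
  ⊓-assoc α β γ = begin
    (α ⊓ β) ⊓ γ                      ≈⟨ ⊓-cong (⊓-rep α β) (symK (h-rep γ)) ⟩
    h (rep α ∧ rep β) ⊓ h (rep γ)    ≈⟨ symK (h-∧ _ _) ⟩
    h ((rep α ∧ rep β) ∧ rep γ)      ≈⟨ h-cong (∧-assoc (rep α) (rep β) (rep γ)) ⟩
    h (rep α ∧ (rep β ∧ rep γ))      ≈⟨ h-∧ _ _ ⟩
    h (rep α) ⊓ h (rep β ∧ rep γ)    ≈⟨ ⊓-cong (h-rep α) (symK (⊓-rep β γ)) ⟩
    α ⊓ (β ⊓ γ)                      ∎

  ⊔-assoc : ∀ α β γ → ((α ⊔ β) ⊔ γ) ≈K (α ⊔ (β ⊔ γ))
  ⊔-assoc α β γ = begin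
    (α ⊔ β) ⊔ γ                      ≈⟨ ⊔-cong (⊔-rep α β) (symK (h-rep γ)) ⟩
    h (rep α ∨ rep β) ⊔ h (rep γ)    ≈⟨ symK (h-∨ _ _) ⟩
    h ((rep α ∨ rep β) ∨ rep γ)      ≈⟨ h-cong (∨-assoc (rep α) (rep β) (rep γ)) ⟩
    h (rep α ∨ (rep β ∨ rep γ))      ≈⟨ h-∨ _ _ ⟩
    h (rep α) ⊔ h (rep β ∨ rep γ)    ≈⟨ ⊔-cong (h-rep α) (symK (⊔-rep β γ)) ⟩
    α ⊔ (β ⊔ γ)                      ∎

  ⊔-absorbs-⊓ : ∀ α β → (α ⊔ (α ⊓ β)) ≈K α
  ⊔-absorbs-⊓ α β = begin
    α ⊔ (α ⊓ β)                      ≈⟨ ⊔-cong (symK (h-rep α)) (⊓-rep α β) ⟩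
    h (rep α) ⊔ h (rep α ∧ rep β)    ≈⟨ symK (h-∨ _ _) ⟩
    h (rep α ∨ (rep α ∧ rep β))      ≈⟨ h-cong (∨-absorbs-∧ (rep α) (rep β)) ⟩
    h (rep α)                        ≈⟨ h-rep α ⟩
    α                                ∎

  ⊓-absorbs-⊔ : ∀ α β → (α ⊓ (α ⊔ β)) ≈K α
  ⊓-absorbs-⊔ α β = begin
    α ⊓ (α ⊔ β)                      ≈⟨ ⊓-cong (symK (h-rep α)) (⊔-rep α β) ⟩
    h (rep α) ⊓ h (rep α ∨ rep β)    ≈⟨ symK (h-∧ _ _) ⟩
    h (rep α ∧ (rep α ∨ rep β))      ≈⟨ h-cong (∧-absorbs-∨ (rep α) (rep β)) ⟩
    h (rep α)                        ≈⟨ h-rep α ⟩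
    α                                ∎

  ⊔-distribˡ-⊓ : ∀ α β γ → (α ⊔ (β ⊓ γ)) ≈K ((α ⊔ β) ⊓ (α ⊔ γ))
  ⊔-distribˡ-⊓ α β γ = begin
    α ⊔ (β ⊓ γ)                               ≈⟨ ⊔-cong (symK (h-rep α)) (⊓-rep β γ) ⟩
    h (rep α) ⊔ h (rep β ∧ rep γ)             ≈⟨ symK (h-∨ _ _) ⟩
    h (rep α ∨ (rep β ∧ rep γ))               ≈⟨ h-cong (∨-distribˡ-∧ (rep α) (rep β) (rep γ)) ⟩
    h ((rep α ∨ rep β) ∧ (rep α ∨ rep γ))     ≈⟨ h-∧ _ _ ⟩
    h (rep α ∨ rep β) ⊓ h (rep α ∨ rep γ)     ≈⟨ ⊓-cong (symK (⊔-rep α β)) (symK (⊔-rep α γ)) ⟩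
    (α ⊔ β) ⊓ (α ⊔ γ)                         ∎

  ⊓-distribˡ-⊔ : ∀ α β γ → (α ⊓ (β ⊔ γ)) ≈K ((α ⊓ β) ⊔ (α ⊓ γ))
  ⊓-distribˡ-⊔ α β γ = begin
    α ⊓ (β ⊔ γ)                               ≈⟨ ⊓-cong (symK (h-rep α)) (⊔-rep β γ) ⟩
    h (rep α) ⊓ h (rep β ∨ rep γ)             ≈⟨ symK (h-∧ _ _) ⟩
    h (rep α ∧ (rep β ∨ rep γ))               ≈⟨ h-cong (∧-distribˡ-∨ (rep α) (rep β) (rep γ)) ⟩
    h ((rep α ∧ rep β) ∨ (rep α ∧ rep γ))     ≈⟨ h-∨ _ _ ⟩
    h (rep α ∧ rep β) ⊔ h (rep α ∧ rep γ)     ≈⟨ ⊔-cong (symK (⊓-rep α β)) (symK (⊓-rep α γ)) ⟩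
    (α ⊓ β) ⊔ (α ⊓ γ)                         ∎

  ⊓-identityʳ : ∀ α → (α ⊓ h ⊤) ≈K α
  ⊓-identityʳ α = begin
    α ⊓ h ⊤             ≈⟨ ⊓-cong (symK (h-rep α)) reflK ⟩
    h (rep α) ⊓ h ⊤     ≈⟨ symK (h-∧ _ _) ⟩
    h (rep α ∧ ⊤)       ≈⟨ h-cong (∧-identityʳ (rep α)) ⟩
    h (rep α)           ≈⟨ h-rep α ⟩
    α                   ∎

  ⊔-identityʳ : ∀ α → (α ⊔ h ⊥) ≈K α
  ⊔-identityʳ α = begin
    α ⊔ h ⊥             ≈⟨ ⊔-cong (symK (h-rep α)) reflK ⟩
    h (rep α) ⊔ h ⊥     ≈⟨ symK (h-∨ _ _) ⟩
    h (rep α ∨ ⊥)       ≈⟨ h-cong (∨-identityʳ (rep α)) ⟩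
    h (rep α)           ≈⟨ h-rep α ⟩
    α                   ∎

  image-isBDL : IsBoundedDistributiveLattice _≈K_ _⊓_ _⊔_ (h ⊤) (h ⊥)
  image-isBDL = record
    { isDistributiveLattice = record
      { isLattice = record
        { isEquivalence = ≈K-isEquivalence
        ; ∨-comm        = ⊔-comm
        ; ∨-assoc       = ⊔-assoc
        ; ∨-cong        = ⊔-cong
        ; ∧-comm        = ⊓-comm
        ; ∧-assoc       = ⊓-assoc
        ; ∧-cong        = ⊓-cong
        ; absorptive    = ⊔-absorbs-⊓ , ⊓-absorbs-⊔
        }
      ; ∨-distrib-∧ = comm∧distrˡ⇒distr ⊓-cong ⊔-comm ⊔-distribˡ-⊓
      ; ∧-distrib-∨ = comm∧distrˡ⇒distr ⊔-cong ⊓-comm ⊓-distribˡ-⊔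
      }
    ; ∧-identityʳ = ⊓-identityʳ
    ; ∨-identityʳ = ⊔-identityʳ
    }

module DoubleNegation {c ℓ} (A : SMA c ℓ) where
  open SMA A
  open IsBoundedDistributiveLattice isBDL
  open LS.IsDistributiveLattice isDistributiveLattice

  setoid : Setoid c ℓ
  setoid = record { isEquivalence = isEquivalence }

  open SetoidReasoning setoid

  infix 8 _″
  _″ : Carrier → Carrier
  a ″ = (a ′) ′

  ″-cong : ∀ {a b} → a ≈ b → a ″ ≈ b ″
  ″-cong p = ′-cong (′-cong p)

  ′-absorbs-″ : ∀ a → (a ″) ′ ≈ a ′
  ′-absorbs-″ a = sym (′′′ a)

  ″-idem : ∀ a → (a ″) ″ ≈ a ″
  ″-idem a = ′-cong (′-absorbs-″ a)

  ″-∧″ : ∀ a b → (a ″ ∧ b ″) ″ ≈ (a ∧ b) ″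
  ″-∧″ a b = begin
    (a ″ ∧ b ″) ″     ≈⟨ ∧′′ (a ″) (b ″) ⟩
    a ″ ″ ∧ b ″ ″     ≈⟨ ∧-cong (″-idem a) (″-idem b) ⟩
    a ″ ∧ b ″         ≈⟨ sym (∧′′ a b) ⟩
    (a ∧ b) ″         ∎

  ″-∨″ : ∀ a b → (a ″ ∨ b ″) ″ ≈ (a ∨ b) ″
  ″-∨″ a b = ′-cong (begin
    (a ″ ∨ b ″) ′       ≈⟨ ∨′ (a ″) (b ″) ⟩
    (a ″) ′ ∧ (b ″) ′   ≈⟨ ∧-cong (′-absorbs-″ a) (′-absorbs-″ b) ⟩
    a ′ ∧ b ′           ≈⟨ sym (∨′ a b) ⟩
    (a ∨ b) ′           ∎)

  ′-∧ : ∀ a b → (a ∧ b) ′ ≈ (a ′ ∨ b ′) ″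
  ′-∧ a b = sym (begin
    ((a ′ ∨ b ′) ′) ′   ≈⟨ ′-cong (∨′ (a ′) (b ′)) ⟩
    (a ″ ∧ b ″) ′       ≈⟨ ′-cong (sym (∧′′ a b)) ⟩
    ((a ∧ b) ″) ′       ≈⟨ ′-absorbs-″ (a ∧ b) ⟩
    (a ∧ b) ′           ∎)

module Kernel {c ℓ} (A : SMA c ℓ) where
  open SMA A
  open IsBoundedDistributiveLattice isBDL
  open LS.IsDistributiveLattice isDistributiveLattice
  open DoubleNegation A
  open SetoidReasoning setoid
  open Plus A using (K; _≈K_; e; h; 𝕃; 𝕂)
  open RawDM 𝕂 using (_∩_; _∪_; _*; 1D; 0D)

  closed : ∀ (α : K) → e α ≈ (e α) ″
  closed (x , a , x≈a″) = begin
    x           ≈⟨ x≈a″ ⟩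
    a ″         ≈⟨ sym (″-idem a) ⟩
    (a ″) ″     ≈⟨ sym (″-cong x≈a″) ⟩
    x ″         ∎

  h∘e : ∀ α → h (e α) ≈K α
  h∘e α = sym (closed α)

  h-∧ : ∀ a b → h (a ∧ b) ≈K (h a ∩ h b)
  h-∧ a b = sym (″-∧″ a b)

  h-∨ : ∀ a b → h (a ∨ b) ≈K (h a ∪ h b)
  h-∨ a b = trans (sym (″-∨″ a b)) (sym (″-idem (a ″ ∨ b ″)))

  h-surj : ∀ α → ∃ λ a → h a ≈K α
  h-surj α = e α , h∘e α

  K-isEquivalence : IsEquivalence _≈K_
  K-isEquivalence = record { refl = refl ; sym = sym ; trans = trans }

  K-isBDL : IsBoundedDistributiveLattice _≈K_ _∩_ _∪_ 1D 0D
  K-isBDL = HomomorphicImage.image-isBDL isBDL K-isEquivalence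
    (λ p q → ″-cong (∧-cong p q)) (λ p q → ″-cong (″-cong (∨-cong p q)))
    h ″-cong h-∧ h-∨ h-surj

  *-involutive : ∀ α → ((α *) *) ≈K α
  *-involutive α = let x = e α in begin
    ((((x ′) ″) ′) ″)   ≈⟨ ″-cong (′-absorbs-″ (x ′)) ⟩
    (x ″) ″             ≈⟨ ″-idem x ⟩
    x ″                 ≈⟨ sym (closed α) ⟩
    x                   ∎

  ∪-* : ∀ α β → ((α ∪ β) *) ≈K ((α *) ∩ (β *))
  ∪-* α β = let x = e α ; y = e β in begin
    ((((x ∨ y) ″) ″) ′) ″    ≈⟨ ″-cong (′-absorbs-″ ((x ∨ y) ″)) ⟩
    (((x ∨ y) ″) ′) ″        ≈⟨ ″-cong (′-absorbs-″ (x ∨ y)) ⟩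
    ((x ∨ y) ′) ″            ≈⟨ ″-cong (∨′ x y) ⟩
    (x ′ ∧ y ′) ″            ≈⟨ sym (″-∧″ (x ′) (y ′)) ⟩
    ((x ′) ″ ∧ (y ′) ″) ″    ∎

  ∩-* : ∀ α β → ((α ∩ β) *) ≈K ((α *) ∪ (β *))
  ∩-* α β = let x = e α ; y = e β in begin
    (((x ∧ y) ″) ′) ″              ≈⟨ ″-cong (′-absorbs-″ (x ∧ y)) ⟩
    ((x ∧ y) ′) ″                  ≈⟨ ″-cong (′-∧ x y) ⟩
    ((x ′ ∨ y ′) ″) ″              ≈⟨ ″-cong (sym (″-∨″ (x ′) (y ′))) ⟩
    (((x ′) ″ ∨ (y ′) ″) ″) ″      ∎

  K-isDeMorgan : IsDeMorganAlgebra _≈K_ _∩_ _∪_ _* 1D 0D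
  K-isDeMorgan = record
    { isBDL  = K-isBDL
    ; *-cong = λ p → ″-cong (′-cong p)
    ; 0*     = ″-cong (trans (′-absorbs-″ ⊥) ⊥′)
    ; 1*     = ″-cong (trans (′-absorbs-″ ⊤) ⊤′)
    ; ∪*     = ∪-*
    ; ∩*     = ∩-*
    ; **     = *-involutive
    }

  -- e preserves meets: meets of closed elements are closed
  e-∩ : ∀ α β → (e α ∧ e β) ≈ e (α ∩ β)
  e-∩ α β = let x = e α ; y = e β in sym (begin
    (x ∧ y) ″       ≈⟨ ∧′′ x y ⟩
    x ″ ∧ y ″       ≈⟨ ∧-cong (sym (closed α)) (sym (closed β)) ⟩
    x ∧ y           ∎)

  isHSMA : IsHSMA 𝕃 𝕂 e h
  isHSMA = record
    { L-isBDL      = isBDL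
    ; D-isDeMorgan = K-isDeMorgan
    ; e-cong       = λ p → p
    ; e-order-emb  = λ α β → mk⇔ (trans (e-∩ α β)) (trans (sym (e-∩ α β)))
    ; e-∩          = e-∩
    ; e-1          = trans (′-cong ⊤′) ⊥′
    ; e-0          = trans (′-cong ⊥′) ⊤′
    ; h-cong       = ″-cong
    ; h-∧          = h-∧
    ; h-∨          = h-∨
    ; h-surj       = h-surj
    ; h∘e          = h∘e
    }

  ∩-complement : IsDPL A → ∀ α → (α ∩ (α *)) ≈K 0D
  ∩-complement dpl α = let x = e α in begin
    (x ∧ (x ′) ″) ″     ≈⟨ ″-cong (∧-cong (closed α) (′-absorbs-″ x)) ⟩
    (x ″ ∧ x ′) ″       ≈⟨ ″-cong (∧-comm (x ″) (x ′)) ⟩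
    (x ′ ∧ x ″) ″       ≈⟨ ″-cong (dpl x) ⟩
    ⊥ ″                 ∎

  isHDPL : IsDPL A → IsHDPL 𝕃 𝕂 e h
  isHDPL dpl = record { isHSMA = isHSMA ; D-compl = ∩-complement dpl }

proposition3p8 : ∀ {c ℓ : Level} →
    ((A : SMA c ℓ) → IsHSMA (Plus.𝕃 A) (Plus.𝕂 A) (Plus.e A) (Plus.h A))
    × ((A : SMA c ℓ) → IsDPL A → IsHDPL (Plus.𝕃 A) (Plus.𝕂 A) (Plus.e A) (Plus.h A))
proposition3p8 = Kernel.isHSMA , Kernel.isHDPL
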